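{- Let $n\geq 1$, let $U_{6n}=\langle a,b\mid a^{2n}=b^3=1,\ a^{ -1}ba=b^{ -1}\rangle$, and let $\Gamma=\Gamma(U_{6n})$ be its non-commuting graph. Then the vertex-cover polynomial of $\Gamma$ is $$\psi(\Gamma;x)=x^{5n}+\sum_{k=1}^{n}\left(\binom{2n}{k}+3\binom{n}{k}\right)x^{5n-k}+\sum_{k=n+1}^{2n}\binom{2n}{k}x^{5n-k}.$$
   Context: The group $U_{6n}$ has order $6n$ and center $Z(U_{6n})=\langle a^2\rangle$. For a finite group $G$, the non-commuting graph $\Gamma(G)$ has vertex set $G\setminus Z(G)$, and two distinct vertices $x,y$ are adjacent iff $xy\neq yx$. A vertex cover is a set $S$ of vertices such that every edge has at least one endpoint in $S$. The vertex-cover polynomial is $\psi(\Gamma,x)=\sum_{i=0}^{|V(\Gamma)|}c_ix^i$, where $c_i$ is the number of vertex covers of cardinality $i$. -}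

module Defs where

open import Data.Nat using (ℕ; zero; suc; _+_; _*_; _∸_; _<ᵇ_; _≟_)
open import Data.Nat.DivMod using (_%_)
open import Data.Nat.Combinatorics using (_C_)
open import Data.Bool using (Bool; if_then_else_)
open import Data.Product using (_×_; _,_)
open import Data.Product.Properties using (≡-dec)
open import Data.Sum using (_⊎_)
open import Data.List using (List; []; _∷_; _++_; map; concatMap; upTo; filter; length; applyUpTo)
open import Data.Nat.ListAction using (sum)
open import Data.List.Relation.Unary.All using (All; all?)
open import Data.List.Membership.Propositional using (_∈_)
open import Data.List.Membership.DecPropositional using (_∈?_)
open import Relation.Binary.PropositionalEquality using (_≡_; _≢_)
open import Relation.Binary.Definitions using (DecidableEquality)
open import Relation.Nullary using (¬_; Dec; ¬?)
open import Relation.Nullary.Decidable using (_×-dec_; _⊎-dec_; _→-dec_)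

-- Every element is uniquely a^i b^j with 0 ≤ i < 2n, 0 ≤ j < 3; we
-- represent it by the pair (i , j).  From b a = a b^{-1} we get
-- b^j a^k = a^k b^{(-1)^k j}, hence
--   (a^i b^j)(a^k b^l) = a^{i+k} b^{(-1)^k j + l}.

Elt : Set
Elt = ℕ × ℕ

-- addition modulo N for arguments already reduced mod N
addMod : ℕ → ℕ → ℕ → ℕ
addMod N i k = if (i + k) <ᵇ N then i + k else (i + k) ∸ N

-- (-1)^k j  modulo 3  (for 0 ≤ j < 3):  j if k even, 2j mod 3 if k odd
signB : ℕ → ℕ → ℕ
signB k j = if (k % 2) <ᵇ 1 then j else (2 * j) % 3

mul : ℕ → Elt → Elt → Elt
mul n (i , j) (k , l) = addMod (2 * n) i k , (signB k j + l) % 3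

elems : ℕ → List Elt
elems n = concatMap (λ i → map (λ j → (i , j)) (upTo 3)) (upTo (2 * n))

_≟E_ : DecidableEquality Elt
_≟E_ = ≡-dec _≟_ _≟_

Central : ℕ → Elt → Set
Central n g = All (λ h → mul n g h ≡ mul n h g) (elems n)

central? : ∀ n g → Dec (Central n g)
central? n g = all? (λ h → mul n g h ≟E mul n h g) (elems n)

vertices : ℕ → List Elt
vertices n = filter (λ g → ¬? (central? n g)) (elems n)

-- all subsets of a (duplicate-free) list, represented as sublists
subsets : {A : Set} → List A → List (List A)
subsets []       = [] ∷ []
subsets (x ∷ xs) = subsets xs ++ map (x ∷_) (subsets xs)

IsVertexCover : ℕ → List Elt → Set
IsVertexCover n S =
  All (λ x → All (λ y → mul n x y ≢ mul n y x → (x ∈ S ⊎ y ∈ S)) (vertices n)) (vertices n)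

isVertexCover? : ∀ n S → Dec (IsVertexCover n S)
isVertexCover? n S =
  all? (λ x → all? (λ y → ¬? (mul n x y ≟E mul n y x) →-dec
                          ((_∈?_ _≟E_ x S) ⊎-dec (_∈?_ _≟E_ y S)))
                   (vertices n))
       (vertices n)

-- c_i : number of vertex covers of Γ(U_{6n}) of cardinality i,
-- i.e. the coefficient of x^i in the vertex-cover polynomial ψ(Γ; x)
vcCoeff : ℕ → ℕ → ℕ
vcCoeff n i =
  length (filter (λ S → isVertexCover? n S ×-dec (length S ≟ i)) (subsets (vertices n)))

δ : ℕ → ℕ → ℕ
δ a b with a ≟ b
... | Relation.Nullary.yes _ = 1
... | Relation.Nullary.no  _ = 0

sumFromTo : ℕ → ℕ → (ℕ → ℕ) → ℕ
sumFromTo lo hi f = sum (applyUpTo (λ t → f (lo + t)) (suc hi ∸ lo))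

formulaCoeff : ℕ → ℕ → ℕ
formulaCoeff n i =
  δ i (5 * n)
  + sumFromTo 1 n (λ k → ((2 * n) C k + 3 * (n C k)) * δ i (5 * n ∸ k))
  + sumFromTo (suc n) (2 * n) (λ k → ((2 * n) C k) * δ i (5 * n ∸ k))

module Submission where

-- The non-central ones fall into four
-- classes, a^{even} b^{±1} (2n elements) and a^{odd} b^j for j = 0, 1, 2 (n elements
-- each), and two of them commute exactly when they lie in the same class: Γ is the
-- complete multipartite graph K_{2n,n,n,n}.  A vertex set is a cover iff its
-- complement is independent, i.e. lies inside a single class, so the covers of size
-- 5n - k are counted by the k-subsets of the classes: C(2n,k) + 3 C(n,k) for k ≥ 1,
-- and the single empty set for k = 0.

open import Defs
open import Data.Bool using (true; false; if_then_else_)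
open import Data.Empty using (⊥; ⊥-elim)
open import Data.List using (List; []; _∷_; _++_; map; concatMap; filter; length; upTo; applyUpTo; cartesianProduct)
open import Data.List.Properties
  using (map-cong; map-cong-local; map-upTo; filter-++; length-++; filter-none; filter-accept; filter-reject; map-++; map-∘)
open import Data.List.Membership.Propositional using (_∈_)
open import Data.List.Membership.Propositional.Properties
  using (∈-cartesianProduct⁺; ∈-cartesianProduct⁻; ∈-upTo⁺; ∈-upTo⁻; ∈-filter⁻)
open import Data.List.Relation.Binary.Permutation.Propositional using (_↭_; ↭-refl; module PermutationReasoning)
open import Data.List.Relation.Binary.Permutation.Propositional.Properties using (++-comm; ++⁺; map⁺; filter-↭; ↭-length)
open import Data.List.Relation.Unary.All as All using (All; []; _∷_; all?)
import Data.List.Relation.Unary.All.Properties as All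
open import Data.List.Relation.Unary.AllPairs using (_∷_)
open import Data.List.Relation.Unary.Any using (here; there)
open import Data.List.Relation.Unary.Unique.Propositional using (Unique)
open import Data.List.Relation.Unary.Unique.Propositional.Properties using (cartesianProduct⁺; upTo⁺; filter⁺)
open import Data.Nat using (ℕ; zero; suc; _+_; _*_; _∸_; _≤_; _<_; _<ᵇ_; _≟_; _≤?_; z≤n; s≤s; z<s; s<s)
open import Data.Nat.Combinatorics using (_C_; nCk+nC[k+1]≡[n+1]C[k+1]; k>n⇒nCk≡0)
open import Data.Nat.DivMod using (_%_; m%n<n; [m+n]%n≡m%n)
open import Data.Nat.ListAction using (sum)
open import Data.Nat.Properties
open import Algebra.Properties.CommutativeSemigroup +-commutativeSemigroup using (x∙yz≈y∙xz)
open import Data.Product using (_×_; _,_; proj₁; proj₂; map₁; map₂)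
open import Data.Product.Function.NonDependent.Propositional using (_×-⇔_)
open import Data.Sum using (_⊎_; inj₁; inj₂; [_,_]′)
import Data.Sum as Sum
open import Function using (_∘_)
open import Function.Bundles using (_⇔_; mk⇔; Equivalence)
open import Function.Properties.Equivalence using () renaming (trans to ⇔-trans)
open import Relation.Binary.Definitions using (DecidableEquality)
open import Relation.Binary.PropositionalEquality
open import Relation.Nullary using (¬_; ¬?; Dec; yes; no; does; contradiction; _×-dec_; _⊎-dec_; _→-dec_)
open import Relation.Nullary.Decidable using (toWitness; map′)
open import Relation.Unary using (Decidable)

private
  variable
    A B : Set

count : {P : A → Set} → Decidable P → List A → ℕ
count P? xs = length (filter P? xs)

module _ {P : A → Set} (P? : Decidable P) where

  count-++ : ∀ xs ys → count P? (xs ++ ys) ≡ count P? xs + count P? ys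
  count-++ xs ys = trans (cong length (filter-++ P? xs ys)) (length-++ (filter P? xs))

  count-map : (f : B → A) → ∀ xs → count P? (map f xs) ≡ count (P? ∘ f) xs
  count-map f []       = refl
  count-map f (x ∷ xs) with does (P? (f x))
  ... | true  = cong suc (count-map f xs)
  ... | false = count-map f xs

  count-none : ∀ xs → (∀ {x} → x ∈ xs → ¬ P x) → count P? xs ≡ 0
  count-none _ ¬P = cong length (filter-none P? (All.tabulate ¬P))

  count-cong : ∀ {Q : A → Set} (Q? : Decidable Q) xs →
               (∀ {x} → x ∈ xs → P x ⇔ Q x) → count P? xs ≡ count Q? xs
  count-cong Q? []       P⇔Q = refl
  count-cong Q? (x ∷ xs) P⇔Q with P? x | Q? x
  ... | yes _  | yes _ = cong suc (count-cong Q? xs (P⇔Q ∘ there))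
  ... | no  _  | no  _ = count-cong Q? xs (P⇔Q ∘ there)
  ... | yes p  | no ¬q = contradiction (Equivalence.to (P⇔Q (here refl)) p) ¬q
  ... | no ¬p  | yes q = contradiction (Equivalence.from (P⇔Q (here refl)) q) ¬p

  count-↭ : ∀ {xs ys} → xs ↭ ys → count P? xs ≡ count P? ys
  count-↭ = ↭-length ∘ filter-↭ P?

  count-filter : ∀ {Q : A → Set} (Q? : Decidable Q) xs →
                 (∀ {x} → x ∈ xs → P x → Q x) → count P? (filter Q? xs) ≡ count P? xs
  count-filter Q? []       P⇒Q = refl
  count-filter Q? (x ∷ xs) P⇒Q with Q? x
  ... | no ¬Qx = trans (count-filter Q? xs (P⇒Q ∘ there))
                       (sym (cong length (filter-reject P? (¬Qx ∘ P⇒Q (here refl)))))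
  ... | yes _ with does (P? x)
  ...   | true  = cong suc (count-filter Q? xs (P⇒Q ∘ there))
  ...   | false = count-filter Q? xs (P⇒Q ∘ there)

count-cartesianProduct : ∀ {P : A × B → Set} (P? : Decidable P) xs ys →
  count P? (cartesianProduct xs ys) ≡ sum (map (λ x → count P? (map (x ,_) ys)) xs)
count-cartesianProduct P? []       ys = refl
count-cartesianProduct P? (x ∷ xs) ys =
  trans (count-++ P? (map (x ,_) ys) _) (cong (count P? (map (x ,_) ys) +_) (count-cartesianProduct P? xs ys))

sum-map-cong : ∀ {K : Set} {f g : K → ℕ} {cs} → (∀ {c} → c ∈ cs → f c ≡ g c) → sum (map f cs) ≡ sum (map g cs)
sum-map-cong f≡g = cong sum (map-cong-local (All.tabulate f≡g))

sum-map-update : ∀ {K : Set} {cs : List K} {d} (f g : K → ℕ) (e : ℕ) → Unique cs → d ∈ cs →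
                 g d ≡ e + f d → (∀ {c} → c ≢ d → g c ≡ f c) →
                 sum (map g cs) ≡ e + sum (map f cs)
sum-map-update {cs = c ∷ cs} f g e (c∉cs ∷ _) (here refl) gd gc = begin
  g c + sum (map g cs)
    ≡⟨ cong₂ _+_ gd (sum-map-cong (λ c′∈cs → gc (λ c′≡c → All.lookup c∉cs c′∈cs (sym c′≡c)))) ⟩
  e + f c + sum (map f cs)
    ≡⟨ +-assoc e (f c) _ ⟩
  e + sum (map f (c ∷ cs)) ∎
  where open ≡-Reasoning
sum-map-update {cs = c ∷ cs} f g e (c∉cs ∷ cs-unique) (there d∈cs) gd gc = begin
  g c + sum (map g cs)
    ≡⟨ cong₂ _+_ (gc (All.lookup c∉cs d∈cs)) (sum-map-update f g e cs-unique d∈cs gd gc) ⟩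
  f c + (e + sum (map f cs))
    ≡⟨ x∙yz≈y∙xz (f c) e _ ⟩
  e + sum (map f (c ∷ cs)) ∎
  where open ≡-Reasoning

sum-map-zero : ∀ {K : Set} (cs : List K) → sum (map (λ _ → 0) cs) ≡ 0
sum-map-zero []       = refl
sum-map-zero (_ ∷ cs) = sum-map-zero cs

sum-applyUpTo-cong : (f g : ℕ → ℕ) → ∀ m → (∀ {t} → t < m → f t ≡ g t) →
                     sum (applyUpTo f m) ≡ sum (applyUpTo g m)
sum-applyUpTo-cong f g zero    f≡g = refl
sum-applyUpTo-cong f g (suc m) f≡g = cong₂ _+_ (f≡g z<s) (sum-applyUpTo-cong (f ∘ suc) (g ∘ suc) m (f≡g ∘ s<s))

sum-applyUpTo-zero : (f : ℕ → ℕ) → ∀ m → (∀ {t} → t < m → f t ≡ 0) → sum (applyUpTo f m) ≡ 0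
sum-applyUpTo-zero f zero    f≡0 = refl
sum-applyUpTo-zero f (suc m) f≡0 = cong₂ _+_ (f≡0 z<s) (sum-applyUpTo-zero (f ∘ suc) m (f≡0 ∘ s<s))

sum-applyUpTo-single : (f : ℕ → ℕ) → ∀ {m t₀} → t₀ < m → (∀ {t} → t < m → t ≢ t₀ → f t ≡ 0) →
                       sum (applyUpTo f m) ≡ f t₀
sum-applyUpTo-single f {suc m} {zero}   _           vanish =
  trans (cong (f 0 +_) (sum-applyUpTo-zero (f ∘ suc) m (λ t<m → vanish (s<s t<m) (λ ())))) (+-identityʳ (f 0))
sum-applyUpTo-single f {suc m} {suc t₀} (s≤s t₀<m) vanish =
  cong₂ _+_ (vanish z<s (λ ()))
            (sum-applyUpTo-single (f ∘ suc) t₀<m (λ t<m t≢t₀ → vanish (s<s t<m) (t≢t₀ ∘ suc-injective)))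

sum-applyUpTo-periodic : (f : ℕ → ℕ) → (∀ t → f (2 + t) ≡ f t) →
                         ∀ m → sum (applyUpTo f (2 * m)) ≡ m * (f 0 + f 1)
sum-applyUpTo-periodic f periodic zero    = refl
sum-applyUpTo-periodic f periodic (suc m) = begin
  sum (applyUpTo f (2 * suc m))
    ≡⟨ cong (sum ∘ applyUpTo f) (*-suc 2 m) ⟩
  f 0 + (f 1 + sum (applyUpTo (λ t → f (2 + t)) (2 * m)))
    ≡⟨ cong (λ s → f 0 + (f 1 + s)) (sum-applyUpTo-periodic (λ t → f (2 + t)) (periodic ∘ (2 +_)) m) ⟩
  f 0 + (f 1 + m * (f 2 + f 3))
    ≡⟨ cong (λ s → f 0 + (f 1 + m * s)) (cong₂ _+_ (periodic 0) (periodic 1)) ⟩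
  f 0 + (f 1 + m * (f 0 + f 1))
    ≡⟨ +-assoc (f 0) (f 1) _ ⟨
  suc m * (f 0 + f 1) ∎
  where open ≡-Reasoning

complement-size : ∀ {a b N i} → a + b ≡ N → i ≤ N → a ≡ i ⇔ b ≡ N ∸ i
complement-size {a} {b} {N} {i} a+b≡N i≤N = mk⇔
  (λ a≡i → trans (sym (m+n∸m≡n a b)) (cong₂ _∸_ a+b≡N a≡i))
  (λ b≡N∸i → begin
     a           ≡⟨ m+n∸n≡m a b ⟨
     a + b ∸ b   ≡⟨ cong₂ _∸_ a+b≡N b≡N∸i ⟩
     N ∸ (N ∸ i) ≡⟨ m∸[m∸n]≡n i≤N ⟩
     i           ∎)
  where open ≡-Reasoning

splits : List A → List (List A × List A)
splits []       = ([] , []) ∷ []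
splits (x ∷ xs) = map (map₂ (x ∷_)) (splits xs) ++ map (map₁ (x ∷_)) (splits xs)

map-proj₁-splits : {A : Set} (xs : List A) → map proj₁ (splits xs) ≡ subsets xs
map-proj₁-splits []       = refl
map-proj₁-splits {A} (x ∷ xs) = begin
  map proj₁ (map (map₂ (x ∷_)) L ++ map (map₁ (x ∷_)) L)
    ≡⟨ map-++ proj₁ (map (map₂ (x ∷_)) L) _ ⟩
  map proj₁ (map (map₂ (x ∷_)) L) ++ map proj₁ (map (map₁ (x ∷_)) L)
    ≡⟨ cong₂ _++_ (sym (map-∘ L)) (trans (sym (map-∘ L)) (map-∘ L)) ⟩
  map proj₁ L ++ map (x ∷_) (map proj₁ L)
    ≡⟨ cong (λ M → M ++ map (x ∷_) M) (map-proj₁-splits xs) ⟩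
  subsets xs ++ map (x ∷_) (subsets xs) ∎
  where
  open ≡-Reasoning
  L : List (List A × List A)
  L = splits xs

map-proj₂-splits↭subsets : {A : Set} (xs : List A) → map proj₂ (splits xs) ↭ subsets xs
map-proj₂-splits↭subsets []       = ↭-refl
map-proj₂-splits↭subsets {A} (x ∷ xs) = begin
  map proj₂ (map (map₂ (x ∷_)) L ++ map (map₁ (x ∷_)) L)
    ≡⟨ map-++ proj₂ (map (map₂ (x ∷_)) L) _ ⟩
  map proj₂ (map (map₂ (x ∷_)) L) ++ map proj₂ (map (map₁ (x ∷_)) L)
    ≡⟨ cong₂ _++_ (trans (sym (map-∘ L)) (map-∘ L)) (sym (map-∘ L)) ⟩
  map (x ∷_) M ++ M
    ↭⟨ ++-comm (map (x ∷_) M) M ⟩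
  M ++ map (x ∷_) M
    ↭⟨ ++⁺ ih (map⁺ (x ∷_) ih) ⟩
  subsets xs ++ map (x ∷_) (subsets xs) ∎
  where
  open PermutationReasoning
  L : List (List A × List A)
  L = splits xs
  M : List (List A)
  M = map proj₂ L
  ih : M ↭ subsets xs
  ih = map-proj₂-splits↭subsets xs

record Partition (V S C : List A) : Set where
  field
    S⊆V      : ∀ {x} → x ∈ S → x ∈ V
    C⊆V      : ∀ {x} → x ∈ C → x ∈ V
    V⊆S∪C    : ∀ {x} → x ∈ V → x ∈ S ⊎ x ∈ C
    disjoint : ∀ {x} → x ∈ S → x ∈ C → ⊥
    sizes    : length S + length C ≡ length V

splits-partition : {V : List A} → Unique V → All (λ (S , C) → Partition V S C) (splits V)
splits-partition {V = []} _ =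
  record { S⊆V = λ () ; C⊆V = λ () ; V⊆S∪C = λ () ; disjoint = λ () ; sizes = refl } ∷ []
splits-partition {V = x ∷ xs} (x∉xs ∷ xs-unique) =
  All.++⁺ (All.map⁺ (All.map x-in-C ih)) (All.map⁺ (All.map x-in-S ih))
  where
  open Partition
  ih : All (λ (S , C) → Partition xs S C) (splits xs)
  ih = splits-partition xs-unique
  x∉ : x ∈ xs → ⊥
  x∉ x∈xs = All.lookup x∉xs x∈xs refl
  x-in-C : ∀ {S C} → Partition xs S C → Partition (x ∷ xs) S (x ∷ C)
  x-in-C {S} {C} P = record
    { S⊆V      = there ∘ S⊆V P
    ; C⊆V      = λ { (here refl) → here refl ; (there y∈C) → there (C⊆V P y∈C) }
    ; V⊆S∪C    = λ { (here refl) → inj₂ (here refl) ; (there y∈xs) → Sum.map₂ there (V⊆S∪C P y∈xs) }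
    ; disjoint = λ { y∈S (here refl) → x∉ (S⊆V P y∈S) ; y∈S (there y∈C) → disjoint P y∈S y∈C }
    ; sizes    = trans (+-suc (length S) (length C)) (cong suc (sizes P)) }
  x-in-S : ∀ {S C} → Partition xs S C → Partition (x ∷ xs) (x ∷ S) C
  x-in-S P = record
    { S⊆V      = λ { (here refl) → here refl ; (there y∈S) → there (S⊆V P y∈S) }
    ; C⊆V      = there ∘ C⊆V P
    ; V⊆S∪C    = λ { (here refl) → inj₁ (here refl) ; (there y∈xs) → Sum.map₁ there (V⊆S∪C P y∈xs) }
    ; disjoint = λ { (here refl) x∈C → x∉ (C⊆V P x∈C) ; (there y∈S) y∈C → disjoint P y∈S y∈C }
    ; sizes    = cong suc (sizes P) }

module Classes {A K : Set} (_≟ᴷ_ : DecidableEquality K) (κ : A → K) where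

  classSize : K → List A → ℕ
  classSize c = count (λ x → κ x ≟ᴷ c)

  classSize-∷-same : ∀ x xs → classSize (κ x) (x ∷ xs) ≡ suc (classSize (κ x) xs)
  classSize-∷-same x xs = cong length (filter-accept (λ y → κ y ≟ᴷ κ x) refl)

  classSize-∷-other : ∀ {c} x xs → κ x ≢ c → classSize c (x ∷ xs) ≡ classSize c xs
  classSize-∷-other {c} x xs κx≢c = cong length (filter-reject (λ y → κ y ≟ᴷ c) κx≢c)

  InClass : K → List A → Set
  InClass c = All (λ y → κ y ≡ c)

  Homogeneous : List A → Set
  Homogeneous C = All (λ x → All (λ y → κ x ≡ κ y) C) C

  homogeneous-∷ : ∀ {x C} → Homogeneous (x ∷ C) ⇔ InClass (κ x) C
  homogeneous-∷ {x} {C} = mk⇔ to from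
    where
    to : Homogeneous (x ∷ C) → InClass (κ x) C
    to ((_ ∷ κx≡) ∷ _) = All.map sym κx≡
    from : InClass (κ x) C → Homogeneous (x ∷ C)
    from inClass = All.tabulate (λ y∈ → All.tabulate (λ z∈ → trans (≡κx y∈) (sym (≡κx z∈))))
      where
      ≡κx : ∀ {y} → y ∈ x ∷ C → κ y ≡ κ x
      ≡κx (here refl) = refl
      ≡κx (there y∈C) = All.lookup inClass y∈C

  inClassOfSize? : (c : K) (k : ℕ) → Decidable (λ C → InClass c C × length C ≡ k)
  inClassOfSize? c k C = all? (λ y → κ y ≟ᴷ c) C ×-dec (length C ≟ k)

  homogeneousOfSize? : (k : ℕ) → Decidable (λ C → Homogeneous C × length C ≡ k)
  homogeneousOfSize? k C = all? (λ x → all? (λ y → κ x ≟ᴷ κ y) C) C ×-dec (length C ≟ k)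

  homogeneousCount : ℕ → List A → ℕ
  homogeneousCount k xs = count (homogeneousOfSize? k) (subsets xs)

  inClassCount : ∀ c k xs → count (inClassOfSize? c k) (subsets xs) ≡ classSize c xs C k
  inClassCount c zero    []       = refl
  inClassCount c (suc k) []       = refl
  inClassCount c k       (x ∷ xs) = begin
    count P (subsets xs ++ map (x ∷_) (subsets xs))
      ≡⟨ count-++ P (subsets xs) _ ⟩
    count P (subsets xs) + count P (map (x ∷_) (subsets xs))
      ≡⟨ cong₂ _+_ (inClassCount c k xs) (count-map P (x ∷_) (subsets xs)) ⟩
    classSize c xs C k + count (P ∘ (x ∷_)) (subsets xs)
      ≡⟨ extend (κ x ≟ᴷ c) k ⟩
    classSize c (x ∷ xs) C k ∎
    where
    open ≡-Reasoning
    P : Decidable (λ C → InClass c C × length C ≡ k)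
    P = inClassOfSize? c k
    extend : ∀ {c} → Dec (κ x ≡ c) → ∀ k →
             classSize c xs C k + count (inClassOfSize? c k ∘ (x ∷_)) (subsets xs) ≡ classSize c (x ∷ xs) C k
    extend {c} (no κx≢c) k = begin
      classSize c xs C k + count (inClassOfSize? c k ∘ (x ∷_)) (subsets xs)
        ≡⟨ cong (classSize c xs C k +_)
                (count-none (inClassOfSize? c k ∘ (x ∷_)) (subsets xs) (λ { _ ((κx≡c ∷ _) , _) → κx≢c κx≡c })) ⟩
      classSize c xs C k + 0
        ≡⟨ +-identityʳ _ ⟩
      classSize c xs C k
        ≡⟨ cong (_C k) (classSize-∷-other x xs κx≢c) ⟨
      classSize c (x ∷ xs) C k ∎
    extend (yes refl) zero =
      cong (classSize (κ x) xs C 0 +_) (count-none (inClassOfSize? (κ x) 0 ∘ (x ∷_)) (subsets xs) (λ { _ (_ , ()) }))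
    extend (yes refl) (suc k) = begin
      s C suc k + count (inClassOfSize? (κ x) (suc k) ∘ (x ∷_)) (subsets xs)
        ≡⟨ cong (s C suc k +_)
                (count-cong (inClassOfSize? (κ x) (suc k) ∘ (x ∷_)) (inClassOfSize? (κ x) k) (subsets xs) (λ _ → drop-x)) ⟩
      s C suc k + count (inClassOfSize? (κ x) k) (subsets xs)
        ≡⟨ cong (s C suc k +_) (inClassCount (κ x) k xs) ⟩
      s C suc k + s C k
        ≡⟨ +-comm (s C suc k) (s C k) ⟩
      s C k + s C suc k
        ≡⟨ nCk+nC[k+1]≡[n+1]C[k+1] s k ⟩
      suc s C suc k
        ≡⟨ cong (_C suc k) (classSize-∷-same x xs) ⟨
      classSize (κ x) (x ∷ xs) C suc k ∎
      where
      s : ℕ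
      s = classSize (κ x) xs
      drop-x : ∀ {C} → (InClass (κ x) (x ∷ C) × suc (length C) ≡ suc k) ⇔ (InClass (κ x) C × length C ≡ k)
      drop-x = mk⇔ (λ { ((_ ∷ inClass) , |C|≡k) → inClass , suc-injective |C|≡k })
                   (λ { (inClass , |C|≡k) → (refl ∷ inClass) , cong suc |C|≡k })

  homogeneousCount-zero : ∀ xs → homogeneousCount 0 xs ≡ 1
  homogeneousCount-zero []       = refl
  homogeneousCount-zero (x ∷ xs) = begin
    count H (subsets xs ++ map (x ∷_) (subsets xs))
      ≡⟨ count-++ H (subsets xs) _ ⟩
    homogeneousCount 0 xs + count H (map (x ∷_) (subsets xs))
      ≡⟨ cong₂ _+_ (homogeneousCount-zero xs) (count-map H (x ∷_) (subsets xs)) ⟩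
    1 + count (H ∘ (x ∷_)) (subsets xs)
      ≡⟨ cong (1 +_) (count-none (H ∘ (x ∷_)) (subsets xs) (λ { _ (_ , ()) })) ⟩
    1 ∎
    where
    open ≡-Reasoning
    H : Decidable (λ C → Homogeneous C × length C ≡ 0)
    H = homogeneousOfSize? 0

  homogeneousCount-∷ : ∀ k x xs →
    homogeneousCount (suc k) (x ∷ xs) ≡ classSize (κ x) xs C k + homogeneousCount (suc k) xs
  homogeneousCount-∷ k x xs = begin
    count H (subsets xs ++ map (x ∷_) (subsets xs))
      ≡⟨ count-++ H (subsets xs) _ ⟩
    homogeneousCount (suc k) xs + count H (map (x ∷_) (subsets xs))
      ≡⟨ cong (homogeneousCount (suc k) xs +_) (count-map H (x ∷_) (subsets xs)) ⟩
    homogeneousCount (suc k) xs + count (H ∘ (x ∷_)) (subsets xs)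
      ≡⟨ cong (homogeneousCount (suc k) xs +_)
              (count-cong (H ∘ (x ∷_)) (inClassOfSize? (κ x) k) (subsets xs) (λ _ → drop-x)) ⟩
    homogeneousCount (suc k) xs + count (inClassOfSize? (κ x) k) (subsets xs)
      ≡⟨ cong (homogeneousCount (suc k) xs +_) (inClassCount (κ x) k xs) ⟩
    homogeneousCount (suc k) xs + classSize (κ x) xs C k
      ≡⟨ +-comm (homogeneousCount (suc k) xs) _ ⟩
    classSize (κ x) xs C k + homogeneousCount (suc k) xs ∎
    where
    open ≡-Reasoning
    H : Decidable (λ C → Homogeneous C × length C ≡ suc k)
    H = homogeneousOfSize? (suc k)
    drop-x : ∀ {C} → (Homogeneous (x ∷ C) × suc (length C) ≡ suc k) ⇔ (InClass (κ x) C × length C ≡ k)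
    drop-x = mk⇔ (λ (hom , |C|≡k) → Equivalence.to homogeneous-∷ hom , suc-injective |C|≡k)
                 (λ (inClass , |C|≡k) → Equivalence.from homogeneous-∷ inClass , cong suc |C|≡k)

  module _ {cs : List K} (cs-unique : Unique cs) where

    homogeneousCount-suc : ∀ k xs → All (λ x → κ x ∈ cs) xs →
      homogeneousCount (suc k) xs ≡ sum (map (λ c → classSize c xs C suc k) cs)
    homogeneousCount-suc k []       []             = sym (sum-map-zero cs)
    homogeneousCount-suc k (x ∷ xs) (κx∈cs ∷ κxs∈cs) = begin
      homogeneousCount (suc k) (x ∷ xs)
        ≡⟨ homogeneousCount-∷ k x xs ⟩
      classSize (κ x) xs C k + homogeneousCount (suc k) xs
        ≡⟨ cong (classSize (κ x) xs C k +_) (homogeneousCount-suc k xs κxs∈cs) ⟩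
      classSize (κ x) xs C k + sum (map (λ c → classSize c xs C suc k) cs)
        ≡⟨ sum-map-update (λ c → classSize c xs C suc k) (λ c → classSize c (x ∷ xs) C suc k) _ cs-unique κx∈cs
             pascal (λ c≢κx → cong (_C suc k) (classSize-∷-other x xs (c≢κx ∘ sym))) ⟨
      sum (map (λ c → classSize c (x ∷ xs) C suc k) cs) ∎
      where
      open ≡-Reasoning
      s : ℕ
      s = classSize (κ x) xs
      pascal : classSize (κ x) (x ∷ xs) C suc k ≡ s C k + s C suc k
      pascal = trans (cong (_C suc k) (classSize-∷-same x xs)) (sym (nCk+nC[k+1]≡[n+1]C[k+1] s k))

    length-classSizes : ∀ xs → All (λ x → κ x ∈ cs) xs → length xs ≡ sum (map (λ c → classSize c xs) cs)
    length-classSizes []       []               = sym (sum-map-zero cs)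
    length-classSizes (x ∷ xs) (κx∈cs ∷ κxs∈cs) = trans (cong suc (length-classSizes xs κxs∈cs)) (sym
      (sum-map-update (λ c → classSize c xs) (λ c → classSize c (x ∷ xs)) 1 cs-unique κx∈cs
         (classSize-∷-same x xs) (λ c≢κx → classSize-∷-other x xs (c≢κx ∘ sym))))

module CompleteMultipartite {A K : Set} (_≟ᴷ_ : DecidableEquality K) (κ : A → K)
  (_∼_ : A → A → Set) (V : List A) (V-unique : Unique V)
  (∼⇔κ≡ : ∀ {x y} → x ∈ V → y ∈ V → x ∼ y ⇔ κ x ≡ κ y) where

  open Classes _≟ᴷ_ κ

  Covers : List A → Set
  Covers S = All (λ x → All (λ y → ¬ x ∼ y → x ∈ S ⊎ y ∈ S) V) V

  covers⇔homogeneous : ∀ {S C} → Partition V S C → Covers S ⇔ Homogeneous C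
  covers⇔homogeneous {S} {C} P = mk⇔ to from
    where
    open Partition P
    to : Covers S → Homogeneous C
    to cover = All.tabulate (λ x∈C → All.tabulate (λ y∈C → sameClass x∈C y∈C))
      where
      sameClass : ∀ {x y} → x ∈ C → y ∈ C → κ x ≡ κ y
      sameClass {x} {y} x∈C y∈C with κ x ≟ᴷ κ y
      ... | yes κx≡κy = κx≡κy
      ... | no κx≢κy with All.lookup (All.lookup cover (C⊆V x∈C)) (C⊆V y∈C)
                            (κx≢κy ∘ Equivalence.to (∼⇔κ≡ (C⊆V x∈C) (C⊆V y∈C)))
      ...   | inj₁ x∈S = ⊥-elim (disjoint x∈S x∈C)
      ...   | inj₂ y∈S = ⊥-elim (disjoint y∈S y∈C)
    from : Homogeneous C → Covers S
    from hom = All.tabulate (λ x∈V → All.tabulate (λ y∈V → edgeCovered x∈V y∈V))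
      where
      edgeCovered : ∀ {x y} → x ∈ V → y ∈ V → ¬ x ∼ y → x ∈ S ⊎ y ∈ S
      edgeCovered x∈V y∈V x≁y with V⊆S∪C x∈V | V⊆S∪C y∈V
      ... | inj₁ x∈S | _        = inj₁ x∈S
      ... | inj₂ _   | inj₁ y∈S = inj₂ y∈S
      ... | inj₂ x∈C | inj₂ y∈C =
        ⊥-elim (x≁y (Equivalence.from (∼⇔κ≡ x∈V y∈V) (All.lookup (All.lookup hom x∈C) y∈C)))

  split⇒partition : ∀ {z} → z ∈ splits V → Partition V (proj₁ z) (proj₂ z)
  split⇒partition = All.lookup (splits-partition V-unique)

  module _ (covers? : Decidable Covers) where

    coverOfSize? : (i : ℕ) → Decidable (λ S → Covers S × length S ≡ i)
    coverOfSize? i S = covers? S ×-dec (length S ≟ i)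

    coverCount : ℕ → ℕ
    coverCount i = count (coverOfSize? i) (subsets V)

    coverCount-splits : ∀ i → coverCount i ≡ count (coverOfSize? i ∘ proj₁) (splits V)
    coverCount-splits i =
      trans (cong (count (coverOfSize? i)) (sym (map-proj₁-splits V))) (count-map (coverOfSize? i) proj₁ (splits V))

    coverCount-≤ : ∀ {i} → i ≤ length V → coverCount i ≡ homogeneousCount (length V ∸ i) V
    coverCount-≤ {i} i≤|V| = begin
      coverCount i                                ≡⟨ coverCount-splits i ⟩
      count (coverOfSize? i ∘ proj₁) (splits V)   ≡⟨ count-cong (coverOfSize? i ∘ proj₁) (H ∘ proj₂) (splits V) dual ⟩
      count (H ∘ proj₂) (splits V)                ≡⟨ count-map H proj₂ (splits V) ⟨
      count H (map proj₂ (splits V))              ≡⟨ count-↭ H (map-proj₂-splits↭subsets V) ⟩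
      homogeneousCount (length V ∸ i) V           ∎
      where
      open ≡-Reasoning
      H : Decidable (λ C → Homogeneous C × length C ≡ length V ∸ i)
      H = homogeneousOfSize? (length V ∸ i)
      dual : ∀ {z} → z ∈ splits V →
             (Covers (proj₁ z) × length (proj₁ z) ≡ i) ⇔ (Homogeneous (proj₂ z) × length (proj₂ z) ≡ length V ∸ i)
      dual z∈ = covers⇔homogeneous (split⇒partition z∈)
            ×-⇔ complement-size (Partition.sizes (split⇒partition z∈)) i≤|V|

    coverCount-> : ∀ {i} → length V < i → coverCount i ≡ 0
    coverCount-> {i} |V|<i = trans (coverCount-splits i) (count-none (coverOfSize? i ∘ proj₁) (splits V) tooLarge)
      where
      tooLarge : ∀ {z} → z ∈ splits V → ¬ (Covers (proj₁ z) × length (proj₁ z) ≡ i)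
      tooLarge z∈ (_ , refl) = <⇒≱ |V|<i (m+n≤o⇒m≤o _ (≤-reflexive (Partition.sizes (split⇒partition z∈))))

-- signB k j is definitionally signByParity (k % 2) j.
signByParity : ℕ → ℕ → ℕ
signByParity q j = if q <ᵇ 1 then j else (2 * j) % 3

-- The class of a^i b^j is classOf (i % 2) j: label 4 is the centre {a^{2m}}, label 0
-- is a^{even} b^{±1}, and label 1 + j is a^{odd} b^j.
classOf : ℕ → ℕ → ℕ
classOf zero    zero    = 4
classOf zero    (suc _) = 0
classOf (suc _) j       = suc j

κ : Elt → ℕ
κ (i , j) = classOf (i % 2) j

ClassesCommute : ℕ → ℕ → Set
ClassesCommute c d = c ≡ d ⊎ c ≡ 4 ⊎ d ≡ 4

CommutationRule : ℕ → ℕ → ℕ → ℕ → Set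
CommutationRule p q j l =
  (signByParity q j + l) % 3 ≡ (signByParity p l + j) % 3 ⇔ ClassesCommute (classOf p j) (classOf q l)

_⇔?_ : {X Y : Set} → Dec X → Dec Y → Dec (X ⇔ Y)
x? ⇔? y? = map′ (λ (to , from) → mk⇔ to from) (λ x⇔y → Equivalence.to x⇔y , Equivalence.from x⇔y)
                ((x? →-dec y?) ×-dec (y? →-dec x?))

commutation-table : All (λ p → All (λ q → All (λ j → All (CommutationRule p q j) (upTo 3)) (upTo 3)) (upTo 2)) (upTo 2)
commutation-table =
  toWitness {a? = all? (λ p → all? (λ q → all? (λ j → all? (rule? p q j) (upTo 3)) (upTo 3)) (upTo 2)) (upTo 2)} _
  where
  rule? : ∀ p q j l → Dec (CommutationRule p q j l)
  rule? p q j l = ((signByParity q j + l) % 3 ≟ (signByParity p l + j) % 3)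
                  ⇔? (classOf p j ≟ classOf q l ⊎-dec classOf p j ≟ 4 ⊎-dec classOf q l ≟ 4)

elems≡cartesianProduct : ∀ n → elems n ≡ cartesianProduct (upTo (2 * n)) (upTo 3)
elems≡cartesianProduct n = rows (upTo (2 * n))
  where
  rows : ∀ is → concatMap (λ i → map (i ,_) (upTo 3)) is ≡ cartesianProduct is (upTo 3)
  rows []       = refl
  rows (i ∷ is) = cong (map (i ,_) (upTo 3) ++_) (rows is)

∈-elems⁻ : ∀ {n x} → x ∈ elems n → proj₁ x < 2 * n × proj₂ x < 3
∈-elems⁻ {n} x∈
  with i∈ , j∈ ← ∈-cartesianProduct⁻ (upTo (2 * n)) (upTo 3) (subst (_ ∈_) (elems≡cartesianProduct n) x∈)
  = ∈-upTo⁻ i∈ , ∈-upTo⁻ j∈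

∈-elems⁺ : ∀ {n i j} → i < 2 * n → j < 3 → (i , j) ∈ elems n
∈-elems⁺ {n} i< j< =
  subst (_ ∈_) (sym (elems≡cartesianProduct n)) (∈-cartesianProduct⁺ (∈-upTo⁺ i<) (∈-upTo⁺ j<))

elems-unique : ∀ n → Unique (elems n)
elems-unique n = subst Unique (sym (elems≡cartesianProduct n)) (cartesianProduct⁺ (upTo⁺ (2 * n)) (upTo⁺ 3))

mul-comm⇔ : ∀ n i j k l →
  mul n (i , j) (k , l) ≡ mul n (k , l) (i , j) ⇔ (signB k j + l) % 3 ≡ (signB i l + j) % 3
mul-comm⇔ n i j k l = mk⇔ (cong proj₂) (cong₂ _,_ addMod-comm)
  where
  addMod-comm : addMod (2 * n) i k ≡ addMod (2 * n) k i
  addMod-comm = cong (λ s → if s <ᵇ 2 * n then s else s ∸ 2 * n) (+-comm i k)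

commute⇔classesCommute : ∀ {n x y} → x ∈ elems n → y ∈ elems n →
                         (mul n x y ≡ mul n y x) ⇔ ClassesCommute (κ x) (κ y)
commute⇔classesCommute {n} {i , j} {k , l} x∈ y∈ = ⇔-trans (mul-comm⇔ n i j k l) tableEntry
  where
  tableEntry : (signB k j + l) % 3 ≡ (signB i l + j) % 3 ⇔ ClassesCommute (κ (i , j)) (κ (k , l))
  tableEntry = All.lookup (All.lookup (All.lookup (All.lookup commutation-table
    (∈-upTo⁺ (m%n<n i 2))) (∈-upTo⁺ (m%n<n k 2)))
    (∈-upTo⁺ (proj₂ (∈-elems⁻ {n} x∈)))) (∈-upTo⁺ (proj₂ (∈-elems⁻ {n} y∈)))

centre-central : ∀ {n x} → x ∈ elems n → κ x ≡ 4 → Central n x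
centre-central {n} x∈ κx≡4 =
  All.tabulate (λ h∈ → Equivalence.from (commute⇔classesCommute {n} x∈ h∈) (inj₂ (inj₁ κx≡4)))

noncentral : ∀ {n x} → 1 ≤ n → x ∈ elems n → κ x ≢ 4 → ¬ Central n x
noncentral {n} {x} 1≤n x∈ κx≢4 central = separate (κ x ≟ 0)
  where
  1<2n : 1 < 2 * n
  1<2n = *-monoʳ-≤ 2 1≤n
  separatedBy : ∀ {w} → w ∈ elems n → κ w ≢ 4 → κ x ≢ κ w → ⊥
  separatedBy {w} w∈ κw≢4 κx≢κw =
    excluded (Equivalence.to (commute⇔classesCommute {n} x∈ w∈) (All.lookup central w∈))
    where
    excluded : ClassesCommute (κ x) (κ w) → ⊥
    excluded (inj₁ κx≡κw)       = κx≢κw κx≡κw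
    excluded (inj₂ (inj₁ κx≡4)) = κx≢4 κx≡4
    excluded (inj₂ (inj₂ κw≡4)) = κw≢4 κw≡4
  separate : Dec (κ x ≡ 0) → ⊥
  separate (yes κx≡0) =
    separatedBy {1 , 0} (∈-elems⁺ {n} 1<2n (s≤s z≤n)) (λ ()) (λ κx≡1 → 0≢1+n (trans (sym κx≡0) κx≡1))
  separate (no κx≢0)  =
    separatedBy {0 , 1} (∈-elems⁺ {n} (<-trans (s≤s z≤n) 1<2n) (s≤s (s≤s z≤n))) (λ ()) κx≢0

classOf-≤ : ∀ p {j} → j < 3 → classOf p j ≤ 4
classOf-≤ zero    {zero}  _   = ≤-refl
classOf-≤ zero    {suc j} _   = z≤n
classOf-≤ (suc p) {j}     j<3 = m≤n⇒m≤1+n j<3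

module _ {n : ℕ} {x : Elt} (x∈V : x ∈ vertices n) where

  private
    x∈elems×noncentral : x ∈ elems n × ¬ Central n x
    x∈elems×noncentral = ∈-filter⁻ (λ g → ¬? (central? n g)) x∈V

  vertex∈elems : x ∈ elems n
  vertex∈elems = proj₁ x∈elems×noncentral

  vertex-class-≢ : κ x ≢ 4
  vertex-class-≢ κx≡4 = proj₂ x∈elems×noncentral (centre-central {n} vertex∈elems κx≡4)

  vertex-class-< : κ x < 4
  vertex-class-< = ≤∧≢⇒< (classOf-≤ (proj₁ x % 2) (proj₂ (∈-elems⁻ {n} vertex∈elems))) vertex-class-≢

commute⇔sameClass : ∀ {n x y} → x ∈ vertices n → y ∈ vertices n → (mul n x y ≡ mul n y x) ⇔ κ x ≡ κ y
commute⇔sameClass {n} {x} {y} x∈V y∈V =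
  ⇔-trans (commute⇔classesCommute {n} (vertex∈elems {n} x∈V) (vertex∈elems {n} y∈V)) (mk⇔ noncentralClasses inj₁)
  where
  noncentralClasses : ClassesCommute (κ x) (κ y) → κ x ≡ κ y
  noncentralClasses (inj₁ κx≡κy)       = κx≡κy
  noncentralClasses (inj₂ (inj₁ κx≡4)) = ⊥-elim (vertex-class-≢ {n} x∈V κx≡4)
  noncentralClasses (inj₂ (inj₂ κy≡4)) = ⊥-elim (vertex-class-≢ {n} y∈V κy≡4)

vertices-unique : ∀ n → Unique (vertices n)
vertices-unique n = filter⁺ (λ g → ¬? (central? n g)) (elems-unique n)

open Classes _≟_ κ

rowClassSize : ℕ → ℕ → ℕ
rowClassSize c p = count (λ j → classOf p j ≟ c) (upTo 3)

classSize-elems : ∀ c n → classSize c (elems n) ≡ n * (rowClassSize c 0 + rowClassSize c 1)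
classSize-elems c n = begin
  classSize c (elems n)
    ≡⟨ cong (classSize c) (elems≡cartesianProduct n) ⟩
  classSize c (cartesianProduct (upTo (2 * n)) (upTo 3))
    ≡⟨ count-cartesianProduct (λ x → κ x ≟ c) (upTo (2 * n)) (upTo 3) ⟩
  sum (map (λ i → classSize c (map (i ,_) (upTo 3))) (upTo (2 * n)))
    ≡⟨ cong sum (map-cong (λ i → count-map (λ x → κ x ≟ c) (i ,_) (upTo 3)) (upTo (2 * n))) ⟩
  sum (map row (upTo (2 * n)))
    ≡⟨ cong sum (map-upTo row (2 * n)) ⟩
  sum (applyUpTo row (2 * n))
    ≡⟨ sum-applyUpTo-periodic row (λ t → cong (rowClassSize c) (parity t)) n ⟩
  n * (rowClassSize c 0 + rowClassSize c 1) ∎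
  where
  open ≡-Reasoning
  row : ℕ → ℕ
  row i = rowClassSize c (i % 2)
  parity : ∀ t → (2 + t) % 2 ≡ t % 2
  parity t = trans (cong (_% 2) (+-comm 2 t)) ([m+n]%n≡m%n t 2)

classSize-vertices : ∀ {n c} → 1 ≤ n → c ≢ 4 → classSize c (vertices n) ≡ n * (rowClassSize c 0 + rowClassSize c 1)
classSize-vertices {n} {c} 1≤n c≢4 =
  trans (count-filter (λ x → κ x ≟ c) (λ g → ¬? (central? n g)) (elems n)
                      (λ x∈ κx≡c → noncentral 1≤n x∈ (c≢4 ∘ trans (sym κx≡c))))
        (classSize-elems c n)

vertex-classSizes : ∀ {n} → 1 ≤ n → map (λ c → classSize c (vertices n)) (upTo 4) ≡ 2 * n ∷ n ∷ n ∷ n ∷ []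
vertex-classSizes {n} 1≤n =
  cong₂ _∷_ (trans (classSize-vertices 1≤n (λ ())) (*-comm n 2))
    (cong₂ _∷_ (single 1 (λ ()) refl) (cong₂ _∷_ (single 2 (λ ()) refl) (cong₂ _∷_ (single 3 (λ ()) refl) refl)))
  where
  single : ∀ c → c ≢ 4 → rowClassSize c 0 + rowClassSize c 1 ≡ 1 → classSize c (vertices n) ≡ n
  single c c≢4 one = trans (classSize-vertices 1≤n c≢4) (trans (cong (n *_) one) (*-identityʳ n))

δ-self : ∀ a → δ a a ≡ 1
δ-self a with a ≟ a
... | yes _   = refl
... | no a≢a = contradiction refl a≢a

δ-≢ : ∀ {a b} → a ≢ b → δ a b ≡ 0
δ-≢ {a} {b} a≢b with a ≟ b
... | yes a≡b = contradiction a≡b a≢b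
... | no _    = refl

δ-∸ : ∀ {N i k} → i ≤ N → k ≤ N → δ i (N ∸ k) ≡ δ (N ∸ i) k
δ-∸ {N} {i} {k} i≤N k≤N with i ≟ N ∸ k
... | yes refl = sym (trans (cong (λ j → δ j k) (m∸[m∸n]≡n k≤N)) (δ-self k))
... | no i≢N∸k = sym (δ-≢ (λ N∸i≡k → i≢N∸k (trans (sym (m∸[m∸n]≡n i≤N)) (cong (N ∸_) N∸i≡k))))

t<1+hi∸lo⇒lo+t≤hi : ∀ lo hi {t} → t < suc hi ∸ lo → lo + t ≤ hi
t<1+hi∸lo⇒lo+t≤hi zero     hi       (s≤s t≤hi) = t≤hi
t<1+hi∸lo⇒lo+t≤hi (suc lo) (suc hi) t<        = s≤s (t<1+hi∸lo⇒lo+t≤hi lo hi t<)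
t<1+hi∸lo⇒lo+t≤hi (suc lo) zero     {t} t<    = contradiction (subst (t <_) (0∸n≡0 lo) t<) (λ ())

module _ (lo hi : ℕ) where

  sumFromTo-cong : ∀ {f g} → (∀ {k} → lo ≤ k → k ≤ hi → f k ≡ g k) → sumFromTo lo hi f ≡ sumFromTo lo hi g
  sumFromTo-cong {f} {g} f≡g = sum-applyUpTo-cong (λ t → f (lo + t)) (λ t → g (lo + t)) (suc hi ∸ lo)
    (λ t< → f≡g (m≤m+n lo _) (t<1+hi∸lo⇒lo+t≤hi lo hi t<))

  sumFromTo-zero : ∀ {f} → (∀ {k} → lo ≤ k → k ≤ hi → f k ≡ 0) → sumFromTo lo hi f ≡ 0
  sumFromTo-zero {f} f≡0 = sum-applyUpTo-zero (λ t → f (lo + t)) (suc hi ∸ lo)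
    (λ t< → f≡0 (m≤m+n lo _) (t<1+hi∸lo⇒lo+t≤hi lo hi t<))

  sumFromTo-single : ∀ {f m} → lo ≤ m → m ≤ hi → (∀ {k} → lo ≤ k → k ≤ hi → k ≢ m → f k ≡ 0) →
                     sumFromTo lo hi f ≡ f m
  sumFromTo-single {f} {m} lo≤m m≤hi vanish =
    trans (sum-applyUpTo-single (λ t → f (lo + t)) (∸-monoˡ-< (s≤s m≤hi) lo≤m) vanish′) (cong f (m+[n∸m]≡n lo≤m))
    where
    vanish′ : ∀ {t} → t < suc hi ∸ lo → t ≢ m ∸ lo → f (lo + t) ≡ 0
    vanish′ {t} t< t≢ = vanish (m≤m+n lo t) (t<1+hi∸lo⇒lo+t≤hi lo hi t<)
      (λ lo+t≡m → t≢ (trans (sym (m+n∸m≡n lo t)) (cong (_∸ lo) lo+t≡m)))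

  sumFromTo-δ-in : ∀ (g : ℕ → ℕ) {m} → lo ≤ m → m ≤ hi → sumFromTo lo hi (λ k → g k * δ m k) ≡ g m
  sumFromTo-δ-in g {m} lo≤m m≤hi =
    trans (sumFromTo-single lo≤m m≤hi (λ {k} _ _ k≢m → trans (cong (g k *_) (δ-≢ (k≢m ∘ sym))) (*-zeroʳ (g k))))
          (trans (cong (g m *_) (δ-self m)) (*-identityʳ (g m)))

  sumFromTo-δ-out : ∀ (g : ℕ → ℕ) {m} → m < lo ⊎ hi < m → sumFromTo lo hi (λ k → g k * δ m k) ≡ 0
  sumFromTo-δ-out g {m} outside =
    sumFromTo-zero (λ {k} lo≤k k≤hi → trans (cong (g k *_) (δ-≢ (m≢k lo≤k k≤hi))) (*-zeroʳ (g k)))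
    where
    m≢k : ∀ {k} → lo ≤ k → k ≤ hi → m ≢ k
    m≢k lo≤k k≤hi refl = [ (λ m<lo → <⇒≱ m<lo lo≤k) , (λ hi<m → <⇒≱ hi<m k≤hi) ]′ outside

lowerCoeff upperCoeff : ℕ → ℕ → ℕ
lowerCoeff n k = (2 * n) C k + 3 * (n C k)
upperCoeff n k = (2 * n) C k

independentSetCount : ℕ → ℕ → ℕ
independentSetCount n zero    = 1
independentSetCount n (suc k) = (2 * n) C suc k + 3 * (n C suc k)

formulaCoeff-by-distance : ∀ n m →
  δ m 0 + sumFromTo 1 n (λ k → lowerCoeff n k * δ m k) + sumFromTo (suc n) (2 * n) (λ k → upperCoeff n k * δ m k)
  ≡ independentSetCount n m
formulaCoeff-by-distance n zero =
  cong₂ _+_ (cong₂ _+_ (δ-self 0) (sumFromTo-δ-out 1 n (lowerCoeff n) (inj₁ z<s)))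
            (sumFromTo-δ-out (suc n) (2 * n) (upperCoeff n) (inj₁ z<s))
formulaCoeff-by-distance n (suc m) = byRange (suc m ≤? n) (suc m ≤? 2 * n)
  where
  δ0≡0 : δ (suc m) 0 ≡ 0
  δ0≡0 = δ-≢ {suc m} {0} (λ ())
  byRange : Dec (suc m ≤ n) → Dec (suc m ≤ 2 * n) →
            δ (suc m) 0 + sumFromTo 1 n (λ k → lowerCoeff n k * δ (suc m) k)
                        + sumFromTo (suc n) (2 * n) (λ k → upperCoeff n k * δ (suc m) k)
            ≡ independentSetCount n (suc m)
  byRange (yes m<n) _ =
    trans (cong₂ _+_ (cong₂ _+_ δ0≡0 (sumFromTo-δ-in 1 n (lowerCoeff n) (s≤s z≤n) m<n))
                     (sumFromTo-δ-out (suc n) (2 * n) (upperCoeff n) (inj₁ (s≤s m<n))))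
          (+-identityʳ (lowerCoeff n (suc m)))
  byRange (no m≮n) (yes m<2n) =
    trans (cong₂ _+_ (cong₂ _+_ δ0≡0 (sumFromTo-δ-out 1 n (lowerCoeff n) (inj₂ n<m)))
                     (sumFromTo-δ-in (suc n) (2 * n) (upperCoeff n) n<m m<2n))
          (sym (trans (cong (λ c → upperCoeff n (suc m) + 3 * c) (k>n⇒nCk≡0 n<m)) (+-identityʳ (upperCoeff n (suc m)))))
    where
    n<m : n < suc m
    n<m = ≰⇒> m≮n
  byRange (no m≮n) (no m≮2n) =
    trans (cong₂ _+_ (cong₂ _+_ δ0≡0 (sumFromTo-δ-out 1 n (lowerCoeff n) (inj₂ (≰⇒> m≮n))))
                     (sumFromTo-δ-out (suc n) (2 * n) (upperCoeff n) (inj₂ (≰⇒> m≮2n))))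
          (sym (cong₂ (λ a b → a + 3 * b) (k>n⇒nCk≡0 (≰⇒> m≮2n)) (k>n⇒nCk≡0 (≰⇒> m≮n))))

formulaCoeff-≤ : ∀ {n i} → i ≤ 5 * n → formulaCoeff n i ≡ independentSetCount n (5 * n ∸ i)
formulaCoeff-≤ {n} {i} i≤5n =
  trans (cong₂ _+_ (cong₂ _+_ (δ-∸ {k = 0} i≤5n z≤n) (sumFromTo-cong 1 n (distance (lowerCoeff n) n≤5n)))
                   (sumFromTo-cong (suc n) (2 * n) (distance (upperCoeff n) 2n≤5n)))
        (formulaCoeff-by-distance n (5 * n ∸ i))
  where
  n≤5n : n ≤ 5 * n
  n≤5n = m≤n*m n 5
  2n≤5n : 2 * n ≤ 5 * n
  2n≤5n = *-monoˡ-≤ n {2} {5} (s≤s (s≤s z≤n))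
  distance : ∀ (g : ℕ → ℕ) {lo hi} → hi ≤ 5 * n → ∀ {k} → lo ≤ k → k ≤ hi →
             g k * δ i (5 * n ∸ k) ≡ g k * δ (5 * n ∸ i) k
  distance g hi≤5n {k} _ k≤hi = cong (g k *_) (δ-∸ i≤5n (≤-trans k≤hi hi≤5n))

formulaCoeff-> : ∀ {n i} → 5 * n < i → formulaCoeff n i ≡ 0
formulaCoeff-> {n} {i} 5n<i =
  cong₂ _+_ (cong₂ _+_ (vanish 0) (sumFromTo-zero 1 n (λ {k} _ _ → term (lowerCoeff n) k)))
            (sumFromTo-zero (suc n) (2 * n) (λ {k} _ _ → term (upperCoeff n) k))
  where
  vanish : ∀ k → δ i (5 * n ∸ k) ≡ 0
  vanish k = δ-≢ (λ i≡5n∸k → <⇒≱ 5n<i (≤-trans (≤-reflexive i≡5n∸k) (m∸n≤m (5 * n) k)))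
  term : ∀ (g : ℕ → ℕ) k → g k * δ i (5 * n ∸ k) ≡ 0
  term g k = trans (cong (g k *_) (vanish k)) (*-zeroʳ (g k))

vertex-classes : ∀ n → All (λ x → κ x ∈ upTo 4) (vertices n)
vertex-classes n = All.tabulate (λ x∈V → ∈-upTo⁺ (vertex-class-< {n} x∈V))

length-vertices : ∀ {n} → 1 ≤ n → length (vertices n) ≡ 5 * n
length-vertices {n} 1≤n = begin
  length (vertices n)                               ≡⟨ length-classSizes (upTo⁺ 4) (vertices n) (vertex-classes n) ⟩
  sum (map (λ c → classSize c (vertices n)) (upTo 4)) ≡⟨ cong sum (vertex-classSizes 1≤n) ⟩
  (n + (n + 0)) + (n + (n + (n + 0)))               ≡⟨ +-assoc n (n + 0) _ ⟩
  n + ((n + 0) + (n + (n + (n + 0))))               ≡⟨ cong (λ m → n + (m + (n + (n + (n + 0))))) (+-identityʳ n) ⟩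
  5 * n                                             ∎
  where open ≡-Reasoning

homogeneousCount-vertices : ∀ {n} → 1 ≤ n → ∀ k → homogeneousCount k (vertices n) ≡ independentSetCount n k
homogeneousCount-vertices {n} 1≤n zero    = homogeneousCount-zero (vertices n)
homogeneousCount-vertices {n} 1≤n (suc k) = begin
  homogeneousCount (suc k) (vertices n)
    ≡⟨ homogeneousCount-suc (upTo⁺ 4) k (vertices n) (vertex-classes n) ⟩
  sum (map (λ c → classSize c (vertices n) C suc k) (upTo 4))
    ≡⟨ cong sum (map-∘ {g = _C suc k} {f = λ c → classSize c (vertices n)} (upTo 4)) ⟩
  sum (map (_C suc k) (map (λ c → classSize c (vertices n)) (upTo 4)))
    ≡⟨ cong (sum ∘ map (_C suc k)) (vertex-classSizes 1≤n) ⟩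
  (2 * n) C suc k + 3 * (n C suc k) ∎
  where open ≡-Reasoning

module Γ (n : ℕ) = CompleteMultipartite _≟_ κ (λ x y → mul n x y ≡ mul n y x) (vertices n) (vertices-unique n)
                                         (commute⇔sameClass {n})

corollary4p7 : (n : ℕ) → 1 ≤ n → (i : ℕ) → vcCoeff n i ≡ formulaCoeff n i
corollary4p7 n 1≤n i = byRange (i ≤? 5 * n)
  where
  |V|≡5n : length (vertices n) ≡ 5 * n
  |V|≡5n = length-vertices 1≤n
  byRange : Dec (i ≤ 5 * n) → vcCoeff n i ≡ formulaCoeff n i
  byRange (yes i≤5n) = begin
    vcCoeff n i
      ≡⟨ Γ.coverCount-≤ n (isVertexCover? n) (subst (i ≤_) (sym |V|≡5n) i≤5n) ⟩
    homogeneousCount (length (vertices n) ∸ i) (vertices n)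
      ≡⟨ cong (λ N → homogeneousCount (N ∸ i) (vertices n)) |V|≡5n ⟩
    homogeneousCount (5 * n ∸ i) (vertices n)
      ≡⟨ homogeneousCount-vertices 1≤n (5 * n ∸ i) ⟩
    independentSetCount n (5 * n ∸ i)
      ≡⟨ formulaCoeff-≤ i≤5n ⟨
    formulaCoeff n i ∎
    where open ≡-Reasoning
  byRange (no i≰5n) =
    trans (Γ.coverCount-> n (isVertexCover? n) (subst (_< i) (sym |V|≡5n) (≰⇒> i≰5n)))
          (sym (formulaCoeff-> {n} (≰⇒> i≰5n)))
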